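{- For any positive integer $n$, $$\sum_{k=1}^n\binom{n}{k}(-2)^kH_k^2=(-1)^n\left(\frac{H_n^{(2)}}2+H_n^2-2\sum_{k=1}^n\frac{(-1)^k}{k^2}-2H_n\sum_{k=1}^n\frac{(-1)^k}k\right)+(-1)^n\left(-\frac12\left(\sum_{k=1}^n\frac{(-1)^k}k\right)^2+3\sum_{k=1}^n\frac{(-1)^kH_k}k\right)$$ and $$\sum_{k=1}^n\binom{n}{k}(-2)^kH_k=(-1)^nH_n-(-1)^n\sum_{k=1}^n\frac{(-1)^k}k.$$
   Context: $H_n=\sum_{0<k\le n}\frac1k$ and $H_n^{(2)}=\sum_{0<k\le n}\frac1{k^2}$. -}

module Defs where

open import Data.Nat as ℕ using (ℕ; zero; suc)
open import Data.Nat.Combinatorics using (_C_)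
open import Data.Integer as ℤ using (ℤ; +_)
open import Data.Rational using (ℚ; 0ℚ; 1ℚ; _+_; _*_; _-_; -_; _/_)

Σ1 : ℕ → (ℕ → ℚ) → ℚ
Σ1 zero    f = 0ℚ
Σ1 (suc n) f = Σ1 n f + f (suc n)

pow : ℚ → ℕ → ℚ
pow q zero    = 1ℚ
pow q (suc n) = q * pow q n

-- 1/k^m as a rational (value 0 for k = 0, never used)
inv : ℕ → ℕ → ℚ
inv zero    m = 0ℚ
inv (suc k) m = pow (+ 1 / suc k) m

sgn : ℕ → ℚ
sgn k = pow (- 1ℚ) k

H : ℕ → ℚ
H n = Σ1 n (λ k → inv k 1)

H2 : ℕ → ℚ
H2 n = Σ1 n (λ k → inv k 2)

binom : ℕ → ℕ → ℚ
binom n k = + (n C k) / 1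

{-# OPTIONS --safe #-}
-- Write B n g = Σ_{k=0}^n C(n,k) (-2)^k g k.  Pascal's rule gives
-- B (n+1) g = B n g − 2 B n (g ∘ suc), and the absorption identity
-- C(n,k)/(k+1) = C(n+1,k+1)/(n+1) turns −2 B n (k ↦ g (k+1)/(k+1)) into
-- (B (n+1) g − g 0)/(n+1).  The increments of H and of H² have exactly this
-- shape (with g = 1 and g = 2H − 1/k respectively), so B n H, B n (1/k) and
-- B n H² satisfy first-order recurrences in n whose solutions are the closed
-- forms; each inductive step is a polynomial identity once (−1)^n = ±1 is fixed.
module Submission where

open import Defs
open import Data.Nat as ℕ using (ℕ; zero; suc)
open import Data.Integer using (+_)
open import Data.Rational using (ℚ; 0ℚ; 1ℚ; _+_; _*_; _-_; -_; _/_; mkℚ; 1/_; toℚᵘ)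
open import Data.Product using (_×_; _,_)
open import Relation.Binary.PropositionalEquality
  using (_≡_; refl; sym; trans; cong; cong₂; _≗_; module ≡-Reasoning)

open import Data.Nat.Combinatorics using (_C_; nC1≡n; nCk+nC[k+1]≡[n+1]C[k+1]; k>n⇒nCk≡0)
import Data.Nat.Coprimality as Coprimality
import Data.Nat.Properties as ℕ
import Data.Integer as ℤ
import Data.Integer.Properties as ℤ
open import Data.Rational.Properties
  using ( _≟_; +-*-commutativeRing; +-assoc; +-identityˡ; +-identityʳ; *-identityˡ; *-identityʳ
        ; *-zeroˡ; *-distribˡ-+; *-inverseʳ; normalize-coprime
        ; toℚᵘ-injective; toℚᵘ-fromℚᵘ; toℚᵘ-homo-+; toℚᵘ-homo-* )
import Data.Rational.Unnormalised as ℚᵘ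
import Data.Rational.Unnormalised.Properties as ℚᵘ
open import Data.Sum using (_⊎_; inj₁; inj₂)
import Data.Sum as Sum
open import Data.List using (_∷_; [])
open import Level using (0ℓ)
open import Relation.Nullary.Decidable using (dec⇒maybe)
open import Tactic.RingSolver using (solve-∀; solve)
open import Tactic.RingSolver.Core.AlmostCommutativeRing using (AlmostCommutativeRing; fromCommutativeRing)

ℚ-ring : AlmostCommutativeRing 0ℓ 0ℓ
ℚ-ring = fromCommutativeRing +-*-commutativeRing (λ q → dec⇒maybe (0ℚ ≟ q))

Σ₀ : ℕ → (ℕ → ℚ) → ℚ
Σ₀ zero    f = f 0
Σ₀ (suc n) f = Σ₀ n f + f (suc n)

Σ₀-cong : ∀ n {f g : ℕ → ℚ} → f ≗ g → Σ₀ n f ≡ Σ₀ n g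
Σ₀-cong zero    f≗g = f≗g 0
Σ₀-cong (suc n) f≗g = cong₂ _+_ (Σ₀-cong n f≗g) (f≗g (suc n))

Σ₀-distrib-+ : ∀ n (f g : ℕ → ℚ) → Σ₀ n (λ k → f k + g k) ≡ Σ₀ n f + Σ₀ n g
Σ₀-distrib-+ zero    f g = refl
Σ₀-distrib-+ (suc n) f g =
  trans (cong (_+ (f (suc n) + g (suc n))) (Σ₀-distrib-+ n f g))
        (interchange (Σ₀ n f) (Σ₀ n g) (f (suc n)) (g (suc n)))
  where
  interchange : ∀ a b c d → (a + b) + (c + d) ≡ (a + c) + (b + d)
  interchange = solve-∀ ℚ-ring

*-distribˡ-Σ₀ : ∀ n c (f : ℕ → ℚ) → c * Σ₀ n f ≡ Σ₀ n (λ k → c * f k)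
*-distribˡ-Σ₀ zero    c f = refl
*-distribˡ-Σ₀ (suc n) c f =
  trans (*-distribˡ-+ c (Σ₀ n f) (f (suc n))) (cong (_+ c * f (suc n)) (*-distribˡ-Σ₀ n c f))

Σ₀-suc : ∀ n (f : ℕ → ℚ) → Σ₀ (suc n) f ≡ f 0 + Σ₀ n (λ k → f (suc k))
Σ₀-suc zero    f = refl
Σ₀-suc (suc n) f = trans (cong (_+ f (suc (suc n))) (Σ₀-suc n f)) (+-assoc (f 0) _ _)

Σ₀≡head+Σ1 : ∀ n (f : ℕ → ℚ) → Σ₀ n f ≡ f 0 + Σ1 n f
Σ₀≡head+Σ1 zero    f = sym (+-identityʳ (f 0))
Σ₀≡head+Σ1 (suc n) f = trans (cong (_+ f (suc n)) (Σ₀≡head+Σ1 n f)) (+-assoc (f 0) _ _)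

fromℕ : ℕ → ℚ
fromℕ a = + a / 1

toℚᵘ-fromℕ : ∀ a → toℚᵘ (fromℕ a) ℚᵘ.≃ ℚᵘ.mkℚᵘ (+ a) 0
toℚᵘ-fromℕ a = toℚᵘ-fromℚᵘ (ℚᵘ.mkℚᵘ (+ a) 0)

fromℕ-+ : ∀ a b → fromℕ (a ℕ.+ b) ≡ fromℕ a + fromℕ b
fromℕ-+ a b = toℚᵘ-injective (begin
  toℚᵘ (fromℕ (a ℕ.+ b))                  ≈⟨ toℚᵘ-fromℕ (a ℕ.+ b) ⟩
  ℚᵘ.mkℚᵘ (+ (a ℕ.+ b)) 0                  ≡⟨ cong (λ z → ℚᵘ.mkℚᵘ z 0) numerator ⟩
  ℚᵘ.mkℚᵘ (+ a) 0 ℚᵘ.+ ℚᵘ.mkℚᵘ (+ b) 0     ≈⟨ ℚᵘ.+-cong (toℚᵘ-fromℕ a) (toℚᵘ-fromℕ b) ⟨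
  toℚᵘ (fromℕ a) ℚᵘ.+ toℚᵘ (fromℕ b)      ≈⟨ toℚᵘ-homo-+ (fromℕ a) (fromℕ b) ⟨
  toℚᵘ (fromℕ a + fromℕ b)                ∎)
  where
  open ℚᵘ.≃-Reasoning
  numerator : + (a ℕ.+ b) ≡ + a ℤ.* + 1 ℤ.+ + b ℤ.* + 1
  numerator = trans (ℤ.pos-+ a b) (sym (cong₂ ℤ._+_ (ℤ.*-identityʳ (+ a)) (ℤ.*-identityʳ (+ b))))

fromℕ-* : ∀ a b → fromℕ (a ℕ.* b) ≡ fromℕ a * fromℕ b
fromℕ-* a b = toℚᵘ-injective (begin
  toℚᵘ (fromℕ (a ℕ.* b))                  ≈⟨ toℚᵘ-fromℕ (a ℕ.* b) ⟩
  ℚᵘ.mkℚᵘ (+ (a ℕ.* b)) 0                  ≡⟨ cong (λ z → ℚᵘ.mkℚᵘ z 0) (ℤ.pos-* a b) ⟩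
  ℚᵘ.mkℚᵘ (+ a) 0 ℚᵘ.* ℚᵘ.mkℚᵘ (+ b) 0     ≈⟨ ℚᵘ.*-cong (toℚᵘ-fromℕ a) (toℚᵘ-fromℕ b) ⟨
  toℚᵘ (fromℕ a) ℚᵘ.* toℚᵘ (fromℕ b)      ≈⟨ toℚᵘ-homo-* (fromℕ a) (fromℕ b) ⟨
  toℚᵘ (fromℕ a * fromℕ b)                ∎)
  where open ℚᵘ.≃-Reasoning

fromℕ-*-inv : ∀ k → fromℕ (suc k) * inv (suc k) 1 ≡ 1ℚ
fromℕ-*-inv k = begin
  fromℕ (suc k) * inv (suc k) 1  ≡⟨ cong (fromℕ (suc k) *_) (*-identityʳ (+ 1 / suc k)) ⟩
  fromℕ (suc k) * (+ 1 / suc k)  ≡⟨ cong₂ _*_ (normalize-coprime 1+k⊥1)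
                                               (normalize-coprime (Coprimality.sym 1+k⊥1)) ⟩
  p * 1/ p                       ≡⟨ *-inverseʳ p ⟩
  1ℚ                             ∎
  where
  1+k⊥1 = Coprimality.sym (Coprimality.1-coprimeTo (suc k))
  p     = mkℚ (+ suc k) 0 1+k⊥1
  open ≡-Reasoning

open ≡-Reasoning

[k+1]*[n+1]C[k+1]≡[n+1]*nCk : ∀ n k → suc k ℕ.* (suc n C suc k) ≡ suc n ℕ.* (n C k)
[k+1]*[n+1]C[k+1]≡[n+1]*nCk n       zero    =
  trans (ℕ.+-identityʳ (suc n C 1)) (trans (nC1≡n (suc n)) (sym (ℕ.*-identityʳ (suc n))))
[k+1]*[n+1]C[k+1]≡[n+1]*nCk zero    (suc k) = ℕ.*-zeroʳ (suc (suc k))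
[k+1]*[n+1]C[k+1]≡[n+1]*nCk (suc m) (suc j) = begin
  suc (suc j) ℕ.* (suc (suc m) C suc (suc j))
    ≡⟨ cong (suc (suc j) ℕ.*_) (nCk+nC[k+1]≡[n+1]C[k+1] (suc m) (suc j)) ⟨
  suc (suc j) ℕ.* (c ℕ.+ c′)
    ≡⟨ ℕ.*-distribˡ-+ (suc (suc j)) c c′ ⟩
  (c ℕ.+ suc j ℕ.* c) ℕ.+ suc (suc j) ℕ.* c′
    ≡⟨ ℕ.+-assoc c (suc j ℕ.* c) _ ⟩
  c ℕ.+ (suc j ℕ.* c ℕ.+ suc (suc j) ℕ.* c′)
    ≡⟨ cong (c ℕ.+_) (cong₂ ℕ._+_ ([k+1]*[n+1]C[k+1]≡[n+1]*nCk m j) ([k+1]*[n+1]C[k+1]≡[n+1]*nCk m (suc j))) ⟩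
  c ℕ.+ (suc m ℕ.* (m C j) ℕ.+ suc m ℕ.* (m C suc j))
    ≡⟨ cong (c ℕ.+_) (ℕ.*-distribˡ-+ (suc m) (m C j) (m C suc j)) ⟨
  c ℕ.+ suc m ℕ.* (m C j ℕ.+ m C suc j)
    ≡⟨ cong (λ d → c ℕ.+ suc m ℕ.* d) (nCk+nC[k+1]≡[n+1]C[k+1] m j) ⟩
  suc (suc m) ℕ.* c ∎
  where
  c  = suc m C suc j
  c′ = suc m C suc (suc j)

binom-pascal : ∀ n k → binom (suc n) (suc k) ≡ binom n k + binom n (suc k)
binom-pascal n k = trans (cong fromℕ (sym (nCk+nC[k+1]≡[n+1]C[k+1] n k))) (fromℕ-+ (n C k) (n C suc k))

binom-n-[1+n]≡0 : ∀ n → binom n (suc n) ≡ 0ℚ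
binom-n-[1+n]≡0 n = cong fromℕ (k>n⇒nCk≡0 (ℕ.n<1+n n))

cross-cancel : ∀ c d p r K N → K * d ≡ N * c → K * p ≡ 1ℚ → N * r ≡ 1ℚ → c * p ≡ r * d
cross-cancel c d p r K N Kd≡Nc Kp≡1 Nr≡1 = begin
  c * p                ≡⟨ solve (c ∷ p ∷ []) ℚ-ring ⟩
  1ℚ * (c * p)         ≡⟨ cong (_* (c * p)) Nr≡1 ⟨
  (N * r) * (c * p)    ≡⟨ solve (N ∷ r ∷ c ∷ p ∷ []) ℚ-ring ⟩
  (r * p) * (N * c)    ≡⟨ cong ((r * p) *_) Kd≡Nc ⟨
  (r * p) * (K * d)    ≡⟨ solve (r ∷ p ∷ K ∷ d ∷ []) ℚ-ring ⟩
  (K * p) * (r * d)    ≡⟨ cong (_* (r * d)) Kp≡1 ⟩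
  1ℚ * (r * d)         ≡⟨ solve (r ∷ d ∷ []) ℚ-ring ⟩
  r * d                ∎

binom-absorb : ∀ n k → binom n k * inv (suc k) 1 ≡ inv (suc n) 1 * binom (suc n) (suc k)
binom-absorb n k = cross-cancel _ _ _ _ (fromℕ (suc k)) (fromℕ (suc n)) (begin
  fromℕ (suc k) * binom (suc n) (suc k)   ≡⟨ fromℕ-* (suc k) (suc n C suc k) ⟨
  fromℕ (suc k ℕ.* (suc n C suc k))       ≡⟨ cong fromℕ ([k+1]*[n+1]C[k+1]≡[n+1]*nCk n k) ⟩
  fromℕ (suc n ℕ.* (n C k))               ≡⟨ fromℕ-* (suc n) (n C k) ⟩
  fromℕ (suc n) * binom n k               ∎)
  (fromℕ-*-inv k) (fromℕ-*-inv n)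

module _ (x : ℚ) where

  binomialTerm : ℕ → (ℕ → ℚ) → ℕ → ℚ
  binomialTerm n g k = binom n k * pow x k * g k

  binomialSum : ℕ → (ℕ → ℚ) → ℚ
  binomialSum n g = Σ₀ n (binomialTerm n g)

  binomialSum-cong : ∀ n {f g : ℕ → ℚ} → f ≗ g → binomialSum n f ≡ binomialSum n g
  binomialSum-cong n f≗g = Σ₀-cong n (λ k → cong (binom n k * pow x k *_) (f≗g k))

  binomialSum-+ : ∀ n (f g : ℕ → ℚ) → binomialSum n (λ k → f k + g k) ≡ binomialSum n f + binomialSum n g
  binomialSum-+ n f g =
    trans (Σ₀-cong n (λ k → *-distribˡ-+ (binom n k * pow x k) (f k) (g k))) (Σ₀-distrib-+ n _ _)

  binomialSum-* : ∀ n a (f : ℕ → ℚ) → binomialSum n (λ k → a * f k) ≡ a * binomialSum n f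
  binomialSum-* n a f =
    trans (Σ₀-cong n (λ k → commute (binom n k * pow x k) a (f k))) (sym (*-distribˡ-Σ₀ n a _))
    where
    commute : ∀ c a y → c * (a * y) ≡ a * (c * y)
    commute = solve-∀ ℚ-ring

  binomialTerm-pascal : ∀ n g k →
    binomialTerm (suc n) g (suc k) ≡ x * binomialTerm n (λ j → g (suc j)) k + binomialTerm n g (suc k)
  binomialTerm-pascal n g k =
    trans (cong (λ b → b * pow x (suc k) * g (suc k)) (binom-pascal n k))
          (split x (binom n k) (binom n (suc k)) (pow x k) (g (suc k)))
    where
    split : ∀ x c c′ p y → (c + c′) * (x * p) * y ≡ x * (c * p * y) + c′ * (x * p) * y
    split = solve-∀ ℚ-ring

  binomialSum-extend : ∀ n g → Σ₀ (suc n) (binomialTerm n g) ≡ binomialSum n g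
  binomialSum-extend n g = begin
    binomialSum n g + binom n (suc n) * pow x (suc n) * g (suc n)
      ≡⟨ cong (λ b → binomialSum n g + b * pow x (suc n) * g (suc n)) (binom-n-[1+n]≡0 n) ⟩
    binomialSum n g + 0ℚ * pow x (suc n) * g (suc n)
      ≡⟨ cong (λ z → binomialSum n g + z * g (suc n)) (*-zeroˡ (pow x (suc n))) ⟩
    binomialSum n g + 0ℚ * g (suc n)
      ≡⟨ cong (λ z → binomialSum n g + z) (*-zeroˡ (g (suc n))) ⟩
    binomialSum n g + 0ℚ
      ≡⟨ +-identityʳ (binomialSum n g) ⟩
    binomialSum n g ∎

  binomialSum-pascal : ∀ n g → binomialSum (suc n) g ≡ binomialSum n g + x * binomialSum n (λ k → g (suc k))
  binomialSum-pascal n g = begin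
    binomialSum (suc n) g
      ≡⟨ Σ₀-suc n (binomialTerm (suc n) g) ⟩
    t₀ + Σ₀ n (λ k → binomialTerm (suc n) g (suc k))
      ≡⟨ cong (λ s → t₀ + s) (Σ₀-cong n (binomialTerm-pascal n g)) ⟩
    t₀ + Σ₀ n (λ k → x * binomialTerm n g′ k + binomialTerm n g (suc k))
      ≡⟨ cong (λ s → t₀ + s) (Σ₀-distrib-+ n _ _) ⟩
    t₀ + (Σ₀ n (λ k → x * binomialTerm n g′ k) + tail)
      ≡⟨ cong (λ s → t₀ + (s + tail)) (*-distribˡ-Σ₀ n x _) ⟨
    t₀ + (x * binomialSum n g′ + tail)
      ≡⟨ swap t₀ (x * binomialSum n g′) tail ⟩
    (t₀ + tail) + x * binomialSum n g′
      ≡⟨ cong (_+ x * binomialSum n g′) (trans (sym (Σ₀-suc n (binomialTerm n g))) (binomialSum-extend n g)) ⟩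
    binomialSum n g + x * binomialSum n g′ ∎
    where
    t₀   = binomialTerm n g 0
    g′   = λ k → g (suc k)
    tail = Σ₀ n (λ k → binomialTerm n g (suc k))
    swap : ∀ a b c → a + (b + c) ≡ (a + c) + b
    swap = solve-∀ ℚ-ring

  binomialSum-one : ∀ n → binomialSum n (λ _ → 1ℚ) ≡ pow (1ℚ + x) n
  binomialSum-one zero    = refl
  binomialSum-one (suc n) = begin
    binomialSum (suc n) (λ _ → 1ℚ)                         ≡⟨ binomialSum-pascal n (λ _ → 1ℚ) ⟩
    binomialSum n (λ _ → 1ℚ) + x * binomialSum n (λ _ → 1ℚ) ≡⟨ cong (λ b → b + x * b) (binomialSum-one n) ⟩
    pow (1ℚ + x) n + x * pow (1ℚ + x) n                    ≡⟨ factor x (pow (1ℚ + x) n) ⟩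
    pow (1ℚ + x) (suc n)                                   ∎
    where
    factor : ∀ x p → p + x * p ≡ (1ℚ + x) * p
    factor = solve-∀ ℚ-ring

  binomialSum-absorb : ∀ n g →
    x * binomialSum n (λ k → g (suc k) * inv (suc k) 1) ≡ inv (suc n) 1 * (binomialSum (suc n) g - g 0)
  binomialSum-absorb n g = begin
    x * binomialSum n (λ k → g (suc k) * inv (suc k) 1)
      ≡⟨ *-distribˡ-Σ₀ n x _ ⟩
    Σ₀ n (λ k → x * binomialTerm n (λ j → g (suc j) * inv (suc j) 1) k)
      ≡⟨ Σ₀-cong n absorbTerm ⟩
    Σ₀ n (λ k → inv (suc n) 1 * binomialTerm (suc n) g (suc k))
      ≡⟨ *-distribˡ-Σ₀ n (inv (suc n) 1) _ ⟨
    inv (suc n) 1 * Σ₀ n (λ k → binomialTerm (suc n) g (suc k))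
      ≡⟨ cong (inv (suc n) 1 *_) (trans (cong (_- g 0) (Σ₀-suc n _)) (dropHead (g 0) _)) ⟨
    inv (suc n) 1 * (binomialSum (suc n) g - g 0) ∎
    where
    regroup : ∀ x c p y i → x * (c * p * (y * i)) ≡ (c * i) * (x * p * y)
    regroup = solve-∀ ℚ-ring
    regroup′ : ∀ x r d p y → (r * d) * (x * p * y) ≡ r * (d * (x * p) * y)
    regroup′ = solve-∀ ℚ-ring
    dropHead : ∀ a s → (1ℚ * 1ℚ * a + s) - a ≡ s
    dropHead = solve-∀ ℚ-ring
    absorbTerm : ∀ k → x * binomialTerm n (λ j → g (suc j) * inv (suc j) 1) k
                       ≡ inv (suc n) 1 * binomialTerm (suc n) g (suc k)
    absorbTerm k = begin
      x * (binom n k * pow x k * (g (suc k) * inv (suc k) 1))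
        ≡⟨ regroup x (binom n k) (pow x k) (g (suc k)) (inv (suc k) 1) ⟩
      (binom n k * inv (suc k) 1) * (x * pow x k * g (suc k))
        ≡⟨ cong (_* (x * pow x k * g (suc k))) (binom-absorb n k) ⟩
      (inv (suc n) 1 * binom (suc n) (suc k)) * (x * pow x k * g (suc k))
        ≡⟨ regroup′ x (inv (suc n) 1) (binom (suc n) (suc k)) (pow x k) (g (suc k)) ⟩
      inv (suc n) 1 * binomialTerm (suc n) g (suc k) ∎

  binomialSum-reciprocal : ∀ n →
    x * binomialSum n (λ k → inv (suc k) 1) ≡ inv (suc n) 1 * (pow (1ℚ + x) (suc n) - 1ℚ)
  binomialSum-reciprocal n = begin
    x * binomialSum n (λ k → inv (suc k) 1)
      ≡⟨ cong (x *_) (binomialSum-cong n (λ k → sym (*-identityˡ (inv (suc k) 1)))) ⟩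
    x * binomialSum n (λ k → 1ℚ * inv (suc k) 1)
      ≡⟨ binomialSum-absorb n (λ _ → 1ℚ) ⟩
    inv (suc n) 1 * (binomialSum (suc n) (λ _ → 1ℚ) - 1ℚ)
      ≡⟨ cong (λ b → inv (suc n) 1 * (b - 1ℚ)) (binomialSum-one (suc n)) ⟩
    inv (suc n) 1 * (pow (1ℚ + x) (suc n) - 1ℚ) ∎

  binomialSum-difference : ∀ n {g d : ℕ → ℚ} → (∀ k → g (suc k) ≡ g k + d k) →
    binomialSum (suc n) g ≡ (1ℚ + x) * binomialSum n g + x * binomialSum n d
  binomialSum-difference n {g} {d} g[k+1]≡g[k]+d[k] = begin
    binomialSum (suc n) g
      ≡⟨ binomialSum-pascal n g ⟩
    binomialSum n g + x * binomialSum n (λ k → g (suc k))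
      ≡⟨ cong (λ b → binomialSum n g + x * b)
              (trans (binomialSum-cong n g[k+1]≡g[k]+d[k]) (binomialSum-+ n g d)) ⟩
    binomialSum n g + x * (binomialSum n g + binomialSum n d)
      ≡⟨ collect x (binomialSum n g) (binomialSum n d) ⟩
    (1ℚ + x) * binomialSum n g + x * binomialSum n d ∎
    where
    collect : ∀ x b e → b + x * (b + e) ≡ (1ℚ + x) * b + x * e
    collect = solve-∀ ℚ-ring

  binomialSum≡Σ1 : ∀ n g → g 0 ≡ 0ℚ → binomialSum n g ≡ Σ1 n (binomialTerm n g)
  binomialSum≡Σ1 n g g0≡0 = begin
    binomialSum n g                           ≡⟨ Σ₀≡head+Σ1 n (binomialTerm n g) ⟩
    binomialTerm n g 0 + Σ1 n (binomialTerm n g)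
      ≡⟨ cong (λ y → binom n 0 * pow x 0 * y + Σ1 n (binomialTerm n g)) g0≡0 ⟩
    0ℚ + Σ1 n (binomialTerm n g)              ≡⟨ +-identityˡ _ ⟩
    Σ1 n (binomialTerm n g)                   ∎

-2ℚ : ℚ
-2ℚ = - (+ 2 / 1)

B : ℕ → (ℕ → ℚ) → ℚ
B = binomialSum -2ℚ

altH : ℕ → ℚ
altH n = Σ1 n (λ k → sgn k * inv k 1)

altH2 : ℕ → ℚ
altH2 n = Σ1 n (λ k → sgn k * inv k 2)

altHH : ℕ → ℚ
altHH n = Σ1 n (λ k → sgn k * H k * inv k 1)

sgn≡±1 : ∀ n → sgn n ≡ 1ℚ ⊎ sgn n ≡ - 1ℚ
sgn≡±1 zero    = inj₁ refl
sgn≡±1 (suc n) = Sum.swap (Sum.map (cong (- 1ℚ *_)) (cong (- 1ℚ *_)) (sgn≡±1 n))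

B-inv : ∀ n → B n (λ k → inv k 1) ≡ altH n - H n
B-inv zero    = refl
B-inv (suc n) = begin
  B (suc n) (λ k → inv k 1)                              ≡⟨ binomialSum-pascal -2ℚ n (λ k → inv k 1) ⟩
  B n (λ k → inv k 1) + -2ℚ * B n (λ k → inv (suc k) 1)   ≡⟨ cong₂ _+_ (B-inv n) (binomialSum-reciprocal -2ℚ n) ⟩
  (altH n - H n) + inv (suc n) 1 * (sgn (suc n) - 1ℚ)    ≡⟨ step (altH n) (H n) (sgn n) (inv (suc n) 1) ⟩
  altH (suc n) - H (suc n)                               ∎
  where
  step : ∀ a h s q → (a - h) + q * (- 1ℚ * s - 1ℚ) ≡ (a + (- 1ℚ * s) * q) - (h + q)
  step = solve-∀ ℚ-ring

-- The recurrences below are polynomial identities only modulo s² = 1, so each sign is checked separately.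
B-H-step : ∀ {s} h a q → s ≡ 1ℚ ⊎ s ≡ - 1ℚ →
  - 1ℚ * (s * h - s * a) + q * (- 1ℚ * s - 1ℚ) ≡ (- 1ℚ * s) * (h + q) - (- 1ℚ * s) * (a + (- 1ℚ * s) * q)
B-H-step h a q (inj₁ refl) = solve (h ∷ a ∷ q ∷ []) ℚ-ring
B-H-step h a q (inj₂ refl) = solve (h ∷ a ∷ q ∷ []) ℚ-ring

B-H : ∀ n → B n H ≡ sgn n * H n - sgn n * altH n
B-H zero    = refl
B-H (suc n) = begin
  B (suc n) H
    ≡⟨ binomialSum-difference -2ℚ n {d = λ k → inv (suc k) 1} (λ _ → refl) ⟩
  - 1ℚ * B n H + -2ℚ * B n (λ k → inv (suc k) 1)
    ≡⟨ cong₂ (λ b r → - 1ℚ * b + r) (B-H n) (binomialSum-reciprocal -2ℚ n) ⟩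
  - 1ℚ * (sgn n * H n - sgn n * altH n) + inv (suc n) 1 * (sgn (suc n) - 1ℚ)
    ≡⟨ B-H-step (H n) (altH n) (inv (suc n) 1) (sgn≡±1 n) ⟩
  sgn (suc n) * H (suc n) - sgn (suc n) * altH (suc n) ∎

H²-slope : ℕ → ℚ
H²-slope k = (+ 2 / 1) * H k + - 1ℚ * inv k 1

H²-suc : ∀ k → H (suc k) * H (suc k) ≡ H k * H k + H²-slope (suc k) * inv (suc k) 1
H²-suc k = expand (H k) (inv (suc k) 1)
  where
  expand : ∀ h q → (h + q) * (h + q) ≡ h * h + ((+ 2 / 1) * (h + q) + - 1ℚ * q) * q
  expand = solve-∀ ℚ-ring

B-H²-slope : ∀ n → B n H²-slope ≡ (+ 2 / 1) * (sgn n * H n - sgn n * altH n) + - 1ℚ * (altH n - H n)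
B-H²-slope n = begin
  B n H²-slope
    ≡⟨ binomialSum-+ -2ℚ n _ _ ⟩
  B n (λ k → (+ 2 / 1) * H k) + B n (λ k → - 1ℚ * inv k 1)
    ≡⟨ cong₂ _+_ (binomialSum-* -2ℚ n (+ 2 / 1) H) (binomialSum-* -2ℚ n (- 1ℚ) (λ k → inv k 1)) ⟩
  (+ 2 / 1) * B n H + - 1ℚ * B n (λ k → inv k 1)
    ≡⟨ cong₂ (λ b c → (+ 2 / 1) * b + - 1ℚ * c) (B-H n) (B-inv n) ⟩
  (+ 2 / 1) * (sgn n * H n - sgn n * altH n) + - 1ℚ * (altH n - H n) ∎

H²-closedForm : ℕ → ℚ
H²-closedForm n =
  sgn n * ((H2 n * (+ 1 / 2)) + H n * H n - (+ 2 / 1) * altH2 n - (+ 2 / 1) * H n * altH n)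
  + sgn n * (- ((+ 1 / 2) * (altH n * altH n)) + (+ 3 / 1) * altHH n)

-- r stands for 1/(n+1): inv (n+1) 1 and inv (n+1) 2 unfold to r * 1ℚ and r * (r * 1ℚ).
B-H²-step : ∀ {s} K h b a c r → s ≡ 1ℚ ⊎ s ≡ - 1ℚ →
  let R : ℚ → ℚ → ℚ → ℚ → ℚ → ℚ → ℚ
      R s K h b a c = s * ((K * (+ 1 / 2)) + h * h - (+ 2 / 1) * b - (+ 2 / 1) * h * a)
                      + s * (- ((+ 1 / 2) * (a * a)) + (+ 3 / 1) * c)
      q  = r * 1ℚ
      s′ = - 1ℚ * s
      h′ = h + q
      a′ = a + s′ * q
  in - 1ℚ * R s K h b a c + q * ((+ 2 / 1) * (s′ * h′ - s′ * a′) + - 1ℚ * (a′ - h′))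
     ≡ R s′ (K + r * q) h′ (b + s′ * (r * q)) a′ (c + s′ * h′ * q)
B-H²-step K h b a c r (inj₁ refl) = solve (K ∷ h ∷ b ∷ a ∷ c ∷ r ∷ []) ℚ-ring
B-H²-step K h b a c r (inj₂ refl) = solve (K ∷ h ∷ b ∷ a ∷ c ∷ r ∷ []) ℚ-ring

B-H² : ∀ n → B n (λ k → H k * H k) ≡ H²-closedForm n
B-H² zero    = refl
B-H² (suc n) = begin
  B (suc n) (λ k → H k * H k)
    ≡⟨ binomialSum-difference -2ℚ n H²-suc ⟩
  - 1ℚ * B n (λ k → H k * H k) + -2ℚ * B n (λ k → H²-slope (suc k) * inv (suc k) 1)
    ≡⟨ cong₂ (λ b t → - 1ℚ * b + t) (B-H² n) (binomialSum-absorb -2ℚ n H²-slope) ⟩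
  - 1ℚ * H²-closedForm n + inv (suc n) 1 * (B (suc n) H²-slope - 0ℚ)
    ≡⟨ cong (λ b → - 1ℚ * H²-closedForm n + inv (suc n) 1 * b)
            (trans (+-identityʳ (B (suc n) H²-slope)) (B-H²-slope (suc n))) ⟩
  - 1ℚ * H²-closedForm n
    + inv (suc n) 1 * ((+ 2 / 1) * (sgn (suc n) * H (suc n) - sgn (suc n) * altH (suc n))
                       + - 1ℚ * (altH (suc n) - H (suc n)))
    ≡⟨ B-H²-step (H2 n) (H n) (altH2 n) (altH n) (altHH n) (+ 1 / suc n) (sgn≡±1 n) ⟩
  H²-closedForm (suc n) ∎

-- Both identities also hold for n = 0.
lemma2p1 : ∀ (n : ℕ) → 1 ℕ.≤ n →
    (Σ1 n (λ k → binom n k * pow (- (+ 2 / 1)) k * (H k * H k))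
    ≡ sgn n * ((H2 n * (+ 1 / 2)) + H n * H n - (+ 2 / 1) * Σ1 n (λ k → sgn k * inv k 2) - (+ 2 / 1) * H n * Σ1 n (λ k → sgn k * inv k 1))
    + sgn n * (- ((+ 1 / 2) * (Σ1 n (λ k → sgn k * inv k 1) * Σ1 n (λ k → sgn k * inv k 1))) + (+ 3 / 1) * Σ1 n (λ k → sgn k * H k * inv k 1)))
    × (Σ1 n (λ k → binom n k * pow (- (+ 2 / 1)) k * H k)
    ≡ sgn n * H n - sgn n * Σ1 n (λ k → sgn k * inv k 1))
lemma2p1 n _ =
  trans (sym (binomialSum≡Σ1 -2ℚ n _ refl)) (B-H² n) ,
  trans (sym (binomialSum≡Σ1 -2ℚ n _ refl)) (B-H n)
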